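{- Let $q$ be a square-free positive integer and let $A\subseteq\mathbb{Z}_q^{\ast}$ satisfy $|A|>\frac12\varphi(q)$, where $\varphi$ is Euler's totient function. Then $$A+A+A+A=\{a\in\mathbb{Z}_q:\ a\equiv 0 \pmod{(2,q)}\}.$$
   Context: $\mathbb{Z}_q=\mathbb{Z}/q\mathbb{Z}$ and $\mathbb{Z}_q^{\ast}$ is its group of units. $A+A+A+A=\{a_1+a_2+a_3+a_4: a_i\in A\}$. $(2,q)$ denotes $\gcd(2,q)$; the condition $a\equiv 0 \pmod{(2,q)}$ is well defined on $\mathbb{Z}_q$ since $(2,q)\mid q$. -}

module Defs where

open import Data.Nat using (ℕ; _*_)
open import Data.Nat.Divisibility using (_∣_)
open import Data.Nat.Primality using (Prime)
open import Data.Nat.Coprimality using (coprime?)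
open import Data.Fin using (Fin; toℕ)
open import Data.Fin.Subset using (Subset; ∣_∣)
open import Data.Vec using (tabulate)
open import Relation.Nullary using (¬_; does)

SquareFree : ℕ → Set
SquareFree q = ∀ p → Prime p → ¬ (p * p ∣ q)

-- Z_q is modelled as Fin q (residues 0,…,q-1); x is a unit iff gcd(x,q)=1.
unitsSubset : (q : ℕ) → Subset q
unitsSubset q = tabulate (λ (x : Fin q) → does (coprime? (toℕ x) q))

φ : ℕ → ℕ
φ q = ∣ unitsSubset q ∣

-- Induct on the prime factorisation of q, for four possibly different sets of units
-- X, Y, Z, W with φ(q) < |X| + |Y| and φ(q) < |Z| + |W|.  For q = p·m with p prime,
-- the Chinese remainder theorem splits each set into fibres X_r ⊆ ℤ_m^*, one for every
-- nonzero residue r mod p, and φ(pm) ≥ (p − 1)φ(m) turns the hypothesis into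
-- Σ_r (|X_r| + |Y_r|) > (p − 1)φ(m).  Fixing c with |X_c| maximal (or |Y_c| maximal),
-- φ(m) < |X_c| + |Y_s| then holds for more than half of the nonzero residues s (or the
-- symmetric statement does).  For odd p two such half-sets of residues, one for (X, Y)
-- and one for (Z, W), hit every residue class by pigeonhole; for p = 2 every residue is
-- 1 and the target is even.  The induction hypothesis for the four chosen fibres, lifted
-- back along the Chinese remainder theorem, gives the representation.  Conversely, if q
-- is even all units are odd, so a sum of four of them is even.

module Submission where

open import Defs
open import Data.Nat using (ℕ; _+_; _*_; _<_; _%_; NonZero)
open import Data.Nat.Divisibility using (_∣_)
open import Data.Nat.GCD using (gcd)
open import Data.Nat.Coprimality using (Coprime)
open import Data.Fin using (Fin; toℕ)
open import Data.Fin.Subset using (Subset; _∈_; ∣_∣)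
open import Data.Product using (Σ; _×_; ∃-syntax)
open import Function.Bundles using (_⇔_)
open import Relation.Binary.PropositionalEquality using (_≡_)

open import Data.Bool using (Bool; true; false; _∧_; not; T)
open import Data.Bool.Properties using (∧-identityʳ; T-∧; T-≡)
open import Data.Fin as Fin using (fromℕ<)
open import Data.Fin.Properties using (toℕ-fromℕ<; toℕ<n)
open import Data.List using (_∷_; [])
open import Data.List.Relation.Unary.All as All using (All)
open import Data.Nat
open import Data.Nat.Coprimality using (coprime?; coprime⇒gcd≡1; coprime-divisor)
open import Data.Nat.DivMod
open import Data.Nat.Divisibility
open import Data.Nat.GCD using (gcd[m,n]∣m; gcd[m,n]∣n; gcd-greatest)
open import Data.Nat.LCM using (lcm; lcm-least; gcd*lcm)
open import Data.Nat.ListAction using (product)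
open import Data.Nat.Primality using (Prime; prime⇒irreducible; prime⇒nonZero; ¬prime[1]; prime[2]; productOfPrimes≢0)
open import Data.Nat.Primality.Factorisation using (factorise; PrimeFactorisation)
open import Data.Nat.Properties
open import Data.Nat.Tactic.RingSolver using (solve; solve-∀)
open import Data.Product using (_,_; proj₁; proj₂)
open import Data.Sum using (_⊎_; inj₁; inj₂; [_,_]′)
open import Data.Empty using (⊥-elim)
open import Data.Unit using (tt)
open import Data.Vec as Vec using (Vec; lookup)
open import Data.Vec.Properties using (lookup∘tabulate; lookup⇒[]=)
open import Function using (_∘_)
open import Function.Bundles using (Equivalence; mk⇔)
open import Relation.Binary.PropositionalEquality
open import Relation.Nullary using (Dec; yes; no; does; contradiction)
open import Relation.Nullary.Decidable using (⌊_⌋; toWitness; fromWitness; isYes≗does; T?; _×-dec_)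

open import Algebra.Properties.CommutativeSemigroup +-commutativeSemigroup using (interchange)

-- Finite sums and counting below n

sumBelow : ℕ → (ℕ → ℕ) → ℕ
sumBelow zero    f = 0
sumBelow (suc n) f = f 0 + sumBelow n (f ∘ suc)

syntax sumBelow n (λ x → e) = ∑[ x < n ] e

∑-cong : ∀ n {f g : ℕ → ℕ} → (∀ x → x < n → f x ≡ g x) → ∑[ x < n ] f x ≡ ∑[ x < n ] g x
∑-cong zero    eq = refl
∑-cong (suc n) eq = cong₂ _+_ (eq 0 z<s) (∑-cong n (λ x x<n → eq (suc x) (s<s x<n)))

∑-mono-≤ : ∀ n {f g : ℕ → ℕ} → (∀ x → x < n → f x ≤ g x) → ∑[ x < n ] f x ≤ ∑[ x < n ] g x
∑-mono-≤ zero    le = z≤n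
∑-mono-≤ (suc n) le = +-mono-≤ (le 0 z<s) (∑-mono-≤ n (λ x x<n → le (suc x) (s<s x<n)))

∑-distrib-+ : ∀ n (f g : ℕ → ℕ) → ∑[ x < n ] (f x + g x) ≡ ∑[ x < n ] f x + ∑[ x < n ] g x
∑-distrib-+ zero    f g = refl
∑-distrib-+ (suc n) f g =
  trans (cong (f 0 + g 0 +_) (∑-distrib-+ n (f ∘ suc) (g ∘ suc))) (interchange (f 0) (g 0) _ _)

∑-*ʳ : ∀ n (f : ℕ → ℕ) c → ∑[ x < n ] (f x * c) ≡ (∑[ x < n ] f x) * c
∑-*ʳ zero    f c = refl
∑-*ʳ (suc n) f c = trans (cong (f 0 * c +_) (∑-*ʳ n (f ∘ suc) c)) (sym (*-distribʳ-+ c (f 0) _))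

∑-const : ∀ n c → ∑[ x < n ] c ≡ n * c
∑-const zero    c = refl
∑-const (suc n) c = cong (c +_) (∑-const n c)

∑-++ : ∀ a b (f : ℕ → ℕ) → ∑[ x < a + b ] f x ≡ ∑[ x < a ] f x + ∑[ y < b ] f (a + y)
∑-++ zero    b f = refl
∑-++ (suc a) b f = trans (cong (f 0 +_) (∑-++ a b (f ∘ suc))) (sym (+-assoc (f 0) _ _))

∑-blocks : ∀ k m (f : ℕ → ℕ) → ∑[ z < k * m ] f z ≡ ∑[ r < k ] ∑[ y < m ] f (r * m + y)
∑-blocks zero    m f = refl
∑-blocks (suc k) m f = begin
  ∑[ z < m + k * m ] f z                                    ≡⟨ ∑-++ m (k * m) f ⟩
  ∑[ y < m ] f y + ∑[ z < k * m ] f (m + z)                 ≡⟨ cong (_ +_) (∑-blocks k m (f ∘ (m +_))) ⟩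
  ∑[ y < m ] f y + ∑[ r < k ] ∑[ y < m ] f (m + (r * m + y)) ≡⟨ cong (_ +_) (∑-cong k λ r _ → ∑-cong m λ y _ →
                                                                  cong f (sym (+-assoc m (r * m) y))) ⟩
  ∑[ y < m ] f y + ∑[ r < k ] ∑[ y < m ] f (m + r * m + y)  ∎
  where open ≡-Reasoning

indicator : Bool → ℕ
indicator true  = 1
indicator false = 0

count : ℕ → (ℕ → Bool) → ℕ
count n P = ∑[ x < n ] indicator (P x)

count-cong : ∀ n {P Q : ℕ → Bool} → (∀ x → x < n → P x ≡ Q x) → count n P ≡ count n Q
count-cong n eq = ∑-cong n (λ x x<n → cong indicator (eq x x<n))

count-mono : ∀ n {P Q : ℕ → Bool} → (∀ x → x < n → T (P x) → T (Q x)) → count n P ≤ count n Q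
count-mono n P⇒Q = ∑-mono-≤ n (λ x x<n → indicator-mono (P⇒Q x x<n))
  where
  indicator-mono : ∀ {a b} → (T a → T b) → indicator a ≤ indicator b
  indicator-mono {false}         _   = z≤n
  indicator-mono {true}  {true}  _   = ≤-refl
  indicator-mono {true}  {false} a⇒b = ⊥-elim (a⇒b tt)

count-complement : ∀ n (P : ℕ → Bool) → count n P + count n (not ∘ P) ≡ n
count-complement n P = begin
  count n P + count n (not ∘ P)               ≡⟨ ∑-distrib-+ n (indicator ∘ P) (indicator ∘ not ∘ P) ⟨
  ∑[ x < n ] (indicator (P x) + indicator (not (P x))) ≡⟨ ∑-cong n (λ x _ → indicator-not (P x)) ⟩
  ∑[ x < n ] 1                                  ≡⟨ ∑-const n 1 ⟩
  n * 1                                         ≡⟨ *-identityʳ n ⟩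
  n                                             ∎
  where
  open ≡-Reasoning
  indicator-not : ∀ b → indicator b + indicator (not b) ≡ 1
  indicator-not true  = refl
  indicator-not false = refl

count-split : ∀ n (P Q : ℕ → Bool) →
  count n P ≡ count n (λ x → P x ∧ Q x) + count n (λ x → P x ∧ not (Q x))
count-split n P Q = trans (∑-cong n (λ x _ → indicator-split (P x) (Q x)))
                          (∑-distrib-+ n (λ x → indicator (P x ∧ Q x)) (λ x → indicator (P x ∧ not (Q x))))
  where
  indicator-split : ∀ a b → indicator a ≡ indicator (a ∧ b) + indicator (a ∧ not b)
  indicator-split true  true  = refl
  indicator-split true  false = refl
  indicator-split false _     = refl

count-witness : ∀ n (P : ℕ → Bool) → 0 < count n P → ∃[ x ] x < n × T (P x)
count-witness (suc n) P 0<count with P 0 in P0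
... | true  = 0 , z<s , subst T (sym P0) tt
... | false with count-witness n (P ∘ suc) 0<count
...   | x , x<n , Px = suc x , s<s x<n , Px

count-∧-lowerBound : ∀ n (P Q : ℕ → Bool) → count n P + count n Q ≤ count n (λ x → P x ∧ Q x) + n
count-∧-lowerBound n P Q = begin
  count n P + count n Q                            ≡⟨ cong (_+ count n Q) (count-split n P Q) ⟩
  #P∧Q + count n (λ x → P x ∧ not (Q x)) + count n Q
    ≤⟨ +-monoˡ-≤ (count n Q) (+-monoʳ-≤ #P∧Q
         (count-mono n {λ x → P x ∧ not (Q x)} {not ∘ Q} (λ x _ → ∧-proj₂ (P x)))) ⟩
  #P∧Q + count n (not ∘ Q) + count n Q             ≡⟨ +-assoc #P∧Q (count n (not ∘ Q)) (count n Q) ⟩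
  #P∧Q + (count n (not ∘ Q) + count n Q)           ≡⟨ cong (#P∧Q +_) (+-comm (count n (not ∘ Q)) (count n Q)) ⟩
  #P∧Q + (count n Q + count n (not ∘ Q))           ≡⟨ cong (#P∧Q +_) (count-complement n Q) ⟩
  #P∧Q + n                                         ∎
  where
  open ≤-Reasoning
  #P∧Q = count n (λ x → P x ∧ Q x)
  ∧-proj₂ : ∀ a {b} → T (a ∧ b) → T b
  ∧-proj₂ true Tb = Tb

count-intersect : ∀ n (P Q : ℕ → Bool) → n < count n P + count n Q → ∃[ x ] x < n × T (P x) × T (Q x)
count-intersect n P Q large
  with count-witness n (λ x → P x ∧ Q x) (+-cancelʳ-< n 0 _ (<-≤-trans large (count-∧-lowerBound n P Q)))
... | x , x<n , PQx = x , x<n , Equivalence.to T-∧ PQx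

_without_ : (ℕ → Bool) → ℕ → ℕ → Bool
(Q without y) z = Q z ∧ not (z ≡ᵇ y)

without-≢ : ∀ (Q : ℕ → Bool) {y z} → T (Q z) → z ≢ y → T ((Q without y) z)
without-≢ Q {y} {z} Qz z≢y with z ≡ᵇ y in z≡ᵇy
... | true  = contradiction (≡ᵇ⇒≡ z y (subst T (sym z≡ᵇy) tt)) z≢y
... | false = subst T (sym (∧-identityʳ (Q z))) Qz

count-without : ∀ n (Q : ℕ → Bool) {y} → y < n → T (Q y) → suc (count n (Q without y)) ≡ count n Q
count-without (suc n) Q {zero} _ Qy with Q 0
... | true  = cong suc (count-cong n (λ z _ → ∧-identityʳ (Q (suc z))))
... | false = ⊥-elim Qy
count-without (suc n) Q {suc y} (s<s y<n) Qy = begin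
  suc (indicator (Q 0 ∧ true) + count n ((Q ∘ suc) without y)) ≡⟨ +-suc _ _ ⟨
  indicator (Q 0 ∧ true) + suc (count n ((Q ∘ suc) without y)) ≡⟨ cong₂ _+_ (cong indicator (∧-identityʳ (Q 0)))
                                                                           (count-without n (Q ∘ suc) y<n Qy) ⟩
  indicator (Q 0) + count n (Q ∘ suc)                           ∎
  where open ≡-Reasoning

InjectiveOn : ℕ → (ℕ → Bool) → (ℕ → ℕ) → Set
InjectiveOn a P f = ∀ {x y} → x < a → y < a → T (P x) → T (P y) → f x ≡ f y → x ≡ y

injectiveOn-suc : ∀ {a P f} → InjectiveOn (suc a) P f → InjectiveOn a (P ∘ suc) (f ∘ suc)
injectiveOn-suc injective x<a y<a Px Py = suc-injective ∘ injective (s<s x<a) (s<s y<a) Px Py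

count-≤-injection : ∀ a b (P Q : ℕ → Bool) (f : ℕ → ℕ) →
  (∀ x → x < a → T (P x) → f x < b × T (Q (f x))) → InjectiveOn a P f → count a P ≤ count b Q
count-≤-injection zero    b P Q f maps injective = z≤n
count-≤-injection (suc a) b P Q f maps injective with P 0 in P0
... | false = count-≤-injection a b (P ∘ suc) Q (f ∘ suc) (λ x x<a → maps (suc x) (s<s x<a)) (injectiveOn-suc injective)
... | true  = begin
  suc (count a (P ∘ suc))       ≤⟨ s≤s (count-≤-injection a b (P ∘ suc) (Q without f 0) (f ∘ suc) maps′
                                          (injectiveOn-suc injective)) ⟩
  suc (count b (Q without f 0)) ≡⟨ count-without b Q (proj₁ (maps 0 z<s P0′)) (proj₂ (maps 0 z<s P0′)) ⟩
  count b Q                     ∎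
  where
  open ≤-Reasoning
  P0′ : T (P 0)
  P0′ = subst T (sym P0) tt
  maps′ : ∀ x → x < a → T (P (suc x)) → f (suc x) < b × T ((Q without f 0) (f (suc x)))
  maps′ x x<a Px = proj₁ (maps (suc x) (s<s x<a) Px) ,
    without-≢ Q (proj₂ (maps (suc x) (s<s x<a) Px)) (λ eq → 1+n≢0 (injective (s<s x<a) z<s Px P0′ eq))

-- The reverse inequality is the same bound for the complement of Q.
count-∘-injective : ∀ n (Q : ℕ → Bool) (σ : ℕ → ℕ) → (∀ x → x < n → σ x < n) →
  (∀ x y → x < n → y < n → σ x ≡ σ y → x ≡ y) → count n (Q ∘ σ) ≡ count n Q
count-∘-injective n Q σ σ< injective = ≤-antisym (count-∘-≤ Q) (+-cancelʳ-≤ (count n (not ∘ Q)) _ _ (begin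
  count n Q + count n (not ∘ Q)           ≡⟨ count-complement n Q ⟩
  n                                       ≡⟨ count-complement n (Q ∘ σ) ⟨
  count n (Q ∘ σ) + count n (not ∘ Q ∘ σ) ≤⟨ +-monoʳ-≤ (count n (Q ∘ σ)) (count-∘-≤ (not ∘ Q)) ⟩
  count n (Q ∘ σ) + count n (not ∘ Q)     ∎))
  where
  open ≤-Reasoning
  count-∘-≤ : ∀ R → count n (R ∘ σ) ≤ count n R
  count-∘-≤ R = count-≤-injection n n (R ∘ σ) R σ (λ x x<n Rσx → σ< x x<n , Rσx)
                  (λ x<n y<n _ _ → injective _ _ x<n y<n)

-- A majority lemma

argmax : ∀ n (f : ℕ → ℕ) → ∃[ c ] c < suc n × (∀ x → x < suc n → f x ≤ f c)
argmax zero    f = 0 , z<s , λ { 0 _ → ≤-refl ; (suc _) (s<s ()) }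
argmax (suc n) f with argmax n f
... | c , c<1+n , fc-max with f c ≤? f (suc n)
...   | yes fc≤ = suc n , ≤-refl , λ x x<2+n →
          [ (λ x<1+n → ≤-trans (fc-max x x<1+n) fc≤) , (λ { refl → ≤-refl }) ]′ (m<1+n⇒m<n∨m≡n x<2+n)
...   | no  fc≰ = c , m<n⇒m<1+n c<1+n , λ x x<2+n →
          [ fc-max x , (λ { refl → <⇒≤ (≰⇒> fc≰) }) ]′ (m<1+n⇒m<n∨m≡n x<2+n)

∑-threshold : ∀ n (f : ℕ → ℕ) F G M → (∀ x → x < n → f x ≤ F) →
  let A = λ x → M <ᵇ f x + G in
  ∑[ x < n ] f x + count n (not ∘ A) * G ≤ count n A * F + count n (not ∘ A) * M
∑-threshold n f F G M f≤F = begin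
  ∑[ x < n ] f x + count n (not ∘ A) * G
    ≡⟨ cong (∑[ x < n ] f x +_) (∑-*ʳ n (indicator ∘ not ∘ A) G) ⟨
  ∑[ x < n ] f x + ∑[ x < n ] (indicator (not (A x)) * G)
    ≡⟨ ∑-distrib-+ n f (λ x → indicator (not (A x)) * G) ⟨
  ∑[ x < n ] (f x + indicator (not (A x)) * G)
    ≤⟨ ∑-mono-≤ n (λ x x<n → pointwise x (f≤F x x<n)) ⟩
  ∑[ x < n ] (indicator (A x) * F + indicator (not (A x)) * M)
    ≡⟨ ∑-distrib-+ n (λ x → indicator (A x) * F) (λ x → indicator (not (A x)) * M) ⟩
  ∑[ x < n ] (indicator (A x) * F) + ∑[ x < n ] (indicator (not (A x)) * M)
    ≡⟨ cong₂ _+_ (∑-*ʳ n (indicator ∘ A) F) (∑-*ʳ n (indicator ∘ not ∘ A) M) ⟩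
  count n A * F + count n (not ∘ A) * M ∎
  where
  open ≤-Reasoning
  A = λ x → M <ᵇ f x + G
  pointwise : ∀ x → f x ≤ F → f x + indicator (not (A x)) * G ≤ indicator (A x) * F + indicator (not (A x)) * M
  pointwise x fx≤F with A x in Ax
  ... | true  = +-mono-≤ (≤-trans fx≤F (≤-reflexive (sym (*-identityˡ F)))) z≤n
  ... | false = begin
    f x + 1 * G ≡⟨ cong (f x +_) (*-identityˡ G) ⟩
    f x + G     ≤⟨ ≮⇒≥ (λ M<fx+G → subst T Ax (<⇒<ᵇ M<fx+G)) ⟩
    M           ≡⟨ *-identityˡ M ⟨
    1 * M       ∎

-- Writing n = a + b + k, the two bounds add up to Sf + Sg + k(F + G) ≤ (n + k)M.
combine-thresholds : ∀ {n a a′ b b′ F G M Sf Sg} → a + a′ ≡ n → b + b′ ≡ n → a + b ≤ n → M ≤ F + G →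
  Sf + a′ * G ≤ a * F + a′ * M → Sg + b′ * F ≤ b * G + b′ * M → Sf + Sg ≤ n * M
combine-thresholds {a = a} {a′} {b} {b′} {F} {G} {M} {Sf} {Sg} a+a′≡n b+b′≡n a+b≤n M≤F+G f-bound g-bound
  with m≤n⇒∃[o]m+o≡n a+b≤n
... | k , refl = +-cancelʳ-≤ (k * M + (a * F + b * G)) (Sf + Sg) ((a + b + k) * M) (begin
    Sf + Sg + (k * M + (a * F + b * G))
      ≤⟨ +-monoʳ-≤ (Sf + Sg) (+-monoˡ-≤ (a * F + b * G) (*-monoʳ-≤ k M≤F+G)) ⟩
    Sf + Sg + (k * (F + G) + (a * F + b * G))     ≡⟨ solve (a ∷ b ∷ k ∷ F ∷ G ∷ Sf ∷ Sg ∷ []) ⟩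
    (Sf + (b + k) * G) + (Sg + (a + k) * F)       ≤⟨ +-mono-≤ (subst (λ a′ → Sf + a′ * G ≤ _ + a′ * M) a′≡b+k f-bound)
                                                              (subst (λ b′ → Sg + b′ * F ≤ _ + b′ * M) b′≡a+k g-bound) ⟩
    (a * F + (b + k) * M) + (b * G + (a + k) * M) ≡⟨ solve (a ∷ b ∷ k ∷ F ∷ G ∷ M ∷ []) ⟩
    (a + b + k) * M + (k * M + (a * F + b * G))   ∎)
  where
  open ≤-Reasoning
  a′≡b+k : a′ ≡ b + k
  a′≡b+k = +-cancelˡ-≡ a a′ (b + k) (trans a+a′≡n (+-assoc a b k))
  b′≡a+k : b′ ≡ a + k
  b′≡a+k = +-cancelˡ-≡ b b′ (a + k) (trans b+b′≡n (solve (a ∷ b ∷ k ∷ [])))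

sums-bounded : ∀ n (f g : ℕ → ℕ) F G M → (∀ x → x < n → f x ≤ F) → (∀ x → x < n → g x ≤ G) →
  2 * count n (λ r → M <ᵇ f r + G) ≤ n → 2 * count n (λ s → M <ᵇ F + g s) ≤ n →
  ∑[ x < n ] f x + ∑[ x < n ] g x ≤ n * M
sums-bounded n f g F G M f≤F g≤G few-f few-g with M ≤? F + G
... | yes M≤F+G = combine-thresholds {a = count n A} {count n (not ∘ A)} {count n B} {count n (not ∘ B)} {F} {G}
                    (count-complement n A) (count-complement n B) a+b≤n M≤F+G
                    (∑-threshold n f F G M f≤F) (∑-threshold n g G F M g≤G)
  where
  A = λ r → M <ᵇ f r + G
  B = λ s → M <ᵇ g s + F
  few-g′ : 2 * count n B ≤ n
  few-g′ = subst (λ c → 2 * c ≤ n) (count-cong n (λ s _ → cong (M <ᵇ_) (+-comm F (g s)))) few-g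
  a+b≤n : count n A + count n B ≤ n
  a+b≤n = *-cancelˡ-≤ 2 (begin
    2 * (count n A + count n B)     ≡⟨ *-distribˡ-+ 2 (count n A) _ ⟩
    2 * count n A + 2 * count n B   ≤⟨ +-mono-≤ few-f few-g′ ⟩
    n + n                           ≡⟨ solve (n ∷ []) ⟩
    2 * n                           ∎)
    where open ≤-Reasoning
... | no M≰F+G = begin
  ∑[ x < n ] f x + ∑[ x < n ] g x ≤⟨ +-mono-≤ (∑-mono-≤ n f≤F) (∑-mono-≤ n g≤G) ⟩
  ∑[ x < n ] F + ∑[ x < n ] G     ≡⟨ cong₂ _+_ (∑-const n F) (∑-const n G) ⟩
  n * F + n * G                   ≡⟨ *-distribˡ-+ n F G ⟨
  n * (F + G)                     ≤⟨ *-monoʳ-≤ n (<⇒≤ (≰⇒> M≰F+G)) ⟩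
  n * M                           ∎
  where open ≤-Reasoning

-- If neither maximiser of f or g works, both threshold sets are at most half of [0, n).
majority : ∀ n (f g : ℕ → ℕ) M → n * M < ∑[ x < n ] f x + ∑[ x < n ] g x →
  (∃[ c ] c < n × n < 2 * count n (λ s → M <ᵇ f c + g s)) ⊎
  (∃[ c ] c < n × n < 2 * count n (λ r → M <ᵇ f r + g c))
majority (suc n) f g M large with argmax n f | argmax n g
... | cf , cf<n , f≤fcf | cg , cg<n , g≤gcg
  with suc n <? 2 * count (suc n) (λ s → M <ᵇ f cf + g s) | suc n <? 2 * count (suc n) (λ r → M <ᵇ f r + g cg)
... | yes many | _        = inj₁ (cf , cf<n , many)
... | no _     | yes many = inj₂ (cg , cg<n , many)
... | no few-g | no few-f = contradiction large
  (≤⇒≯ (sums-bounded (suc n) f g (f cf) (g cg) M f≤fcf g≤gcg (≮⇒≥ few-f) (≮⇒≥ few-g)))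

-- Sums of residue classes

%-cong-+ : ∀ {a a′ b b′ n} .{{_ : NonZero n}} → a % n ≡ a′ % n → b % n ≡ b′ % n → (a + b) % n ≡ (a′ + b′) % n
%-cong-+ {a} {a′} {b} {b′} {n} a≡a′ b≡b′ = begin
  (a + b) % n             ≡⟨ %-distribˡ-+ a b n ⟩
  (a % n + b % n) % n     ≡⟨ cong₂ (λ x y → (x + y) % n) a≡a′ b≡b′ ⟩
  (a′ % n + b′ % n) % n   ≡⟨ %-distribˡ-+ a′ b′ n ⟨
  (a′ + b′) % n           ∎
  where open ≡-Reasoning

%-cong-+₄ : ∀ {a₁ a₂ a₃ a₄ b₁ b₂ b₃ b₄ n} .{{_ : NonZero n}} →
  a₁ % n ≡ b₁ % n → a₂ % n ≡ b₂ % n → a₃ % n ≡ b₃ % n → a₄ % n ≡ b₄ % n →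
  (a₁ + a₂ + a₃ + a₄) % n ≡ (b₁ + b₂ + b₃ + b₄) % n
%-cong-+₄ e₁ e₂ e₃ e₄ = %-cong-+ (%-cong-+ (%-cong-+ e₁ e₂) e₃) e₄

-- adding (n − 1)·e is subtracting e modulo n
%-absorb : ∀ e x n .{{_ : NonZero n}} → (e + x + pred n * e) % n ≡ x % n
%-absorb e x n = begin
  (e + x + pred n * e) % n    ≡⟨ cong (_% n) (rearrange e x (pred n)) ⟩
  (x + e * suc (pred n)) % n  ≡⟨ cong (λ m → (x + e * m) % n) (suc-pred n) ⟩
  (x + e * n) % n             ≡⟨ [m+kn]%n≡m%n x e n ⟩
  x % n                       ∎
  where
  open ≡-Reasoning
  rearrange : ∀ e x k → e + x + k * e ≡ x + e * suc k
  rearrange = solve-∀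

%-cancelˡ-+ : ∀ e {x y n} .{{_ : NonZero n}} → (e + x) % n ≡ (e + y) % n → x % n ≡ y % n
%-cancelˡ-+ e {x} {y} {n} e+x≡e+y = begin
  x % n                   ≡⟨ %-absorb e x n ⟨
  (e + x + pred n * e) % n ≡⟨ %-cong-+ e+x≡e+y refl ⟩
  (e + y + pred n * e) % n ≡⟨ %-absorb e y n ⟩
  y % n                   ∎
  where open ≡-Reasoning

sumset-covers : ∀ p .{{_ : NonZero p}} (P Q : ℕ → Bool) → p < count p P + count p Q → ∀ a t →
  ∃[ x ] ∃[ y ] x < p × y < p × T (P x) × T (Q y) × (a + x + y) % p ≡ t % p
sumset-covers p P Q large a t = witness (count-intersect p P (Q ∘ partner) large′)
  where
  -- partner x represents t − a − x modulo p
  partner : ℕ → ℕ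
  partner x = (t + pred p * (a + x)) % p
  partner-sum : ∀ x → (a + x + partner x) % p ≡ t % p
  partner-sum x = begin
    (a + x + partner x) % p                  ≡⟨ %-cong-+ {a + x} refl (m%n%n≡m%n (t + pred p * (a + x)) p) ⟩
    (a + x + (t + pred p * (a + x))) % p     ≡⟨ cong (_% p) (+-assoc (a + x) t _) ⟨
    (a + x + t + pred p * (a + x)) % p       ≡⟨ %-absorb (a + x) t p ⟩
    t % p                                    ∎
    where open ≡-Reasoning
  partner-injective : ∀ x y → x < p → y < p → partner x ≡ partner y → x ≡ y
  partner-injective x y x<p y<p eq = begin
    x                        ≡⟨ m<n⇒m%n≡m x<p ⟨
    x % p                    ≡⟨ %-cancelˡ-+ (partner x + a) (begin
      (partner x + a + x) % p  ≡⟨ cong (_% p) (rotate (partner x) a x) ⟩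
      (a + x + partner x) % p  ≡⟨ trans (partner-sum x) (sym (partner-sum y)) ⟩
      (a + y + partner y) % p  ≡⟨ cong (λ e → (a + y + e) % p) eq ⟨
      (a + y + partner x) % p  ≡⟨ cong (_% p) (rotate (partner x) a y) ⟨
      (partner x + a + y) % p  ∎) ⟩
    y % p                    ≡⟨ m<n⇒m%n≡m y<p ⟩
    y                        ∎
    where
    open ≡-Reasoning
    rotate : ∀ e a x → e + a + x ≡ a + x + e
    rotate = solve-∀
  large′ : p < count p P + count p (Q ∘ partner)
  large′ = subst (λ c → p < count p P + c)
                 (sym (count-∘-injective p Q partner (λ x _ → m%n<n _ p) partner-injective)) large
  witness : (∃[ x ] x < p × T (P x) × T (Q (partner x))) →
    ∃[ x ] ∃[ y ] x < p × y < p × T (P x) × T (Q y) × (a + x + y) % p ≡ t % p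
  witness (x , x<p , Px , Qy) = x , partner x , x<p , m%n<n _ p , Px , Qy , partner-sum x

positive : ℕ → Bool
positive zero    = false
positive (suc _) = true

positive-≢0 : ∀ {x} → x ≢ 0 → T (positive x)
positive-≢0 {zero}  x≢0 = x≢0 refl
positive-≢0 {suc _} _   = tt

positive⇒≢0 : ∀ {x} → T (positive x) → x ≢ 0
positive⇒≢0 {suc _} _ ()

record LargeSplit (p M : ℕ) (f g : ℕ → ℕ) (s : ℕ) : Set where
  constructor largeSplit
  field
    r r′   : ℕ
    r<p    : r < p
    r′<p   : r′ < p
    r+r′≡s : r + r′ ≡ s
    large  : M < f r + g r′

record ManySplits (p M : ℕ) (f g : ℕ → ℕ) : Set where
  constructor manySplits
  field
    c      : ℕ
    S      : ℕ → Bool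
    p<2∣S∣ : p < 2 * count p S
    split  : ∀ s → s < p → T (S s) → LargeSplit p M f g (c + s)

record ResidueChoice (p : ℕ) .{{_ : NonZero p}} (M t : ℕ) (f₁ f₂ f₃ f₄ : ℕ → ℕ) : Set where
  constructor residueChoice
  field
    s₁ s₂   : ℕ
    split₁  : LargeSplit p M f₁ f₂ s₁
    split₂  : LargeSplit p M f₃ f₄ s₂
    s₁+s₂≡t : (s₁ + s₂) % p ≡ t % p

odd<double : ∀ k a → 2 * k < 2 * a → suc (2 * k) < 2 * a
odd<double k a 2k<2a = begin-strict
  suc (2 * k)       <⟨ n<1+n _ ⟩
  suc (suc (2 * k)) ≡⟨ solve (k ∷ []) ⟩
  2 * suc k         ≤⟨ *-monoʳ-≤ 2 (*-cancelˡ-< 2 k a 2k<2a) ⟩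
  2 * a             ∎
  where open ≤-Reasoning

-- majority runs over the 2k nonzero residues; more than k of them is more than half of
-- all 2k + 1 residues.
manySplits-odd : ∀ k M (f g : ℕ → ℕ) →
  2 * k * M < ∑[ i < 2 * k ] f (suc i) + ∑[ i < 2 * k ] g (suc i) → ManySplits (suc (2 * k)) M f g
manySplits-odd k M f g large with majority (2 * k) (f ∘ suc) (g ∘ suc) M large
... | inj₁ (c , c<2k , many) = manySplits (suc c) S (odd<double k (count (2 * k) (S ∘ suc)) many) split
  where
  S : ℕ → Bool
  S s = positive s ∧ (M <ᵇ f (suc c) + g s)
  split : ∀ s → s < suc (2 * k) → T (S s) → LargeSplit (suc (2 * k)) M f g (suc c + s)
  split (suc s) s<p Ss = largeSplit (suc c) (suc s) (s<s c<2k) s<p refl (<ᵇ⇒< M _ Ss)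
... | inj₂ (c , c<2k , many) = manySplits (suc c) S (odd<double k (count (2 * k) (S ∘ suc)) many) split
  where
  S : ℕ → Bool
  S r = positive r ∧ (M <ᵇ f r + g (suc c))
  split : ∀ r → r < suc (2 * k) → T (S r) → LargeSplit (suc (2 * k)) M f g (suc c + r)
  split (suc r) r<p Sr = largeSplit (suc r) (suc c) r<p (s<s c<2k) (+-comm (suc r) (suc c)) (<ᵇ⇒< M _ Sr)

<-halves : ∀ p a b → p < 2 * a → p < 2 * b → p < a + b
<-halves p a b p<2a p<2b = *-cancelˡ-< 2 p (a + b)
  (subst₂ _<_ (cong (p +_) (sym (+-identityʳ p))) (sym (*-distribˡ-+ 2 a b)) (+-mono-< p<2a p<2b))

residues-from-splits : ∀ p .{{_ : NonZero p}} M t {f₁ f₂ f₃ f₄ : ℕ → ℕ} →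
  ManySplits p M f₁ f₂ → ManySplits p M f₃ f₄ → ResidueChoice p M t f₁ f₂ f₃ f₄
residues-from-splits p M t (manySplits c₁ S₁ p<2∣S₁∣ split₁) (manySplits c₂ S₂ p<2∣S₂∣ split₂) =
  choose (sumset-covers p S₁ S₂ (<-halves p (count p S₁) (count p S₂) p<2∣S₁∣ p<2∣S₂∣) (c₁ + c₂) t)
  where
  choose : (∃[ x ] ∃[ y ] x < p × y < p × T (S₁ x) × T (S₂ y) × (c₁ + c₂ + x + y) % p ≡ t % p) →
           ResidueChoice p M t _ _ _ _
  choose (x , y , x<p , y<p , S₁x , S₂y , sum≡t) =
    residueChoice (c₁ + x) (c₂ + y) (split₁ x x<p S₁x) (split₂ y y<p S₂y)
      (trans (cong (_% p) (trans (interchange c₁ x c₂ y) (sym (+-assoc (c₁ + c₂) x y)))) sum≡t)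

residues-mod-2 : ∀ M t (f₁ f₂ f₃ f₄ : ℕ → ℕ) → 2 ∣ t →
  1 * M < ∑[ i < 1 ] f₁ (suc i) + ∑[ i < 1 ] f₂ (suc i) →
  1 * M < ∑[ i < 1 ] f₃ (suc i) + ∑[ i < 1 ] f₄ (suc i) → ResidueChoice 2 M t f₁ f₂ f₃ f₄
residues-mod-2 M t f₁ f₂ f₃ f₄ 2∣t large₁₂ large₃₄ =
  residueChoice 2 2 (split-1+1 large₁₂) (split-1+1 large₃₄) (sym (n∣m⇒m%n≡0 t 2 2∣t))
  where
  split-1+1 : ∀ {f g : ℕ → ℕ} → 1 * M < f 1 + 0 + (g 1 + 0) → LargeSplit 2 M f g 2
  split-1+1 {f} {g} large = largeSplit 1 1 (n<1+n 1) (n<1+n 1) refl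
    (subst₂ _<_ (*-identityˡ M) (cong₂ _+_ (+-identityʳ (f 1)) (+-identityʳ (g 1))) large)

even-or-odd : ∀ n → ∃[ k ] (n ≡ 2 * k ⊎ n ≡ suc (2 * k))
even-or-odd zero = 0 , inj₁ refl
even-or-odd (suc n) with even-or-odd n
... | k , inj₁ refl = k , inj₂ refl
... | k , inj₂ refl = suc k , inj₁ (solve (k ∷ []))

prime-two-or-odd : ∀ {n} → Prime (suc n) → n ≡ 1 ⊎ ∃[ k ] n ≡ 2 * k
prime-two-or-odd {n} prime[1+n] with even-or-odd n
... | k , inj₁ n≡2k = inj₂ (k , n≡2k)
... | k , inj₂ refl with prime⇒irreducible prime[1+n] (divides {2} (suc k) (solve (k ∷ [])))
...   | inj₂ 2≡1+n = inj₁ (suc-injective (sym 2≡1+n))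

chooseResidues : ∀ p .{{_ : NonZero p}} M t (f₁ f₂ f₃ f₄ : ℕ → ℕ) → Prime p → (2 ∣ p → 2 ∣ t) →
  pred p * M < ∑[ i < pred p ] f₁ (suc i) + ∑[ i < pred p ] f₂ (suc i) →
  pred p * M < ∑[ i < pred p ] f₃ (suc i) + ∑[ i < pred p ] f₄ (suc i) → ResidueChoice p M t f₁ f₂ f₃ f₄
chooseResidues (suc n) M t f₁ f₂ f₃ f₄ p-prime parity large₁₂ large₃₄ with prime-two-or-odd p-prime
... | inj₁ refl       = residues-mod-2 M t f₁ f₂ f₃ f₄ (parity (∣-refl {2})) large₁₂ large₃₄
... | inj₂ (k , refl) = residues-from-splits (suc (2 * k)) M t
                          (manySplits-odd k M f₁ f₂ large₁₂) (manySplits-odd k M f₃ f₄ large₃₄)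

-- The Chinese remainder theorem and units

[r*m+y]%m≡y : ∀ r {y m} .{{_ : NonZero m}} → y < m → (r * m + y) % m ≡ y
[r*m+y]%m≡y r {y} {m} y<m = trans (cong (_% m) (+-comm (r * m) y)) (trans ([m+kn]%n≡m%n y r m) (m<n⇒m%n≡m y<m))

[r*m+y]/m≡r : ∀ r {y m} .{{_ : NonZero m}} → y < m → (r * m + y) / m ≡ r
[r*m+y]/m≡r r {y} {m} y<m = begin
  (r * m + y) / m   ≡⟨ +-distrib-/-∣ˡ y (n∣m*n r) ⟩
  r * m / m + y / m ≡⟨ cong₂ _+_ (m*n/n≡m r m) (m<n⇒m/n≡0 y<m) ⟩
  r + 0             ≡⟨ +-identityʳ r ⟩
  r                 ∎
  where open ≡-Reasoning

%-≡⇒∣∸ : ∀ {x y n} .{{_ : NonZero n}} → x ≤ y → x % n ≡ y % n → n ∣ y ∸ x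
%-≡⇒∣∸ {x} {y} {n} x≤y x≡y = m%n≡0⇒n∣m (y ∸ x) n (sym (begin
  0                  ≡⟨ m<n⇒m%n≡m (>-nonZero⁻¹ n) ⟨
  0 % n              ≡⟨ %-cancelˡ-+ x (begin
    (x + 0) % n         ≡⟨ cong (_% n) (+-identityʳ x) ⟩
    x % n               ≡⟨ x≡y ⟩
    y % n               ≡⟨ cong (_% n) (m+[n∸m]≡n x≤y) ⟨
    (x + (y ∸ x)) % n   ∎) ⟩
  (y ∸ x) % n        ∎))
  where open ≡-Reasoning

coprime⇒lcm≡* : ∀ {p m} → Coprime p m → lcm p m ≡ p * m
coprime⇒lcm≡* {p} {m} coprime = begin
  lcm p m            ≡⟨ *-identityˡ (lcm p m) ⟨
  1 * lcm p m        ≡⟨ cong (_* lcm p m) (coprime⇒gcd≡1 coprime) ⟨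
  gcd p m * lcm p m  ≡⟨ gcd*lcm p m ⟩
  p * m              ∎
  where open ≡-Reasoning

crt-≡-ordered : ∀ {p m x y} .{{_ : NonZero (p * m)}} .{{_ : NonZero p}} .{{_ : NonZero m}} → Coprime p m → x ≤ y →
  x % p ≡ y % p → x % m ≡ y % m → x % (p * m) ≡ y % (p * m)
crt-≡-ordered {p} {m} {x} {y} coprime x≤y x≡y[p] x≡y[m] = begin
  x % (p * m)             ≡⟨ %-remove-+ʳ x pm∣y∸x ⟨
  (x + (y ∸ x)) % (p * m) ≡⟨ cong (_% (p * m)) (m+[n∸m]≡n x≤y) ⟩
  y % (p * m)             ∎
  where
  open ≡-Reasoning
  pm∣y∸x : p * m ∣ y ∸ x
  pm∣y∸x = subst (_∣ y ∸ x) (coprime⇒lcm≡* coprime) (lcm-least (%-≡⇒∣∸ x≤y x≡y[p]) (%-≡⇒∣∸ x≤y x≡y[m]))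

crt-≡ : ∀ {p m x y} .{{_ : NonZero (p * m)}} .{{_ : NonZero p}} .{{_ : NonZero m}} → Coprime p m →
  x % p ≡ y % p → x % m ≡ y % m → x % (p * m) ≡ y % (p * m)
crt-≡ {x = x} {y} coprime x≡y[p] x≡y[m] with ≤-total x y
... | inj₁ x≤y = crt-≡-ordered coprime x≤y x≡y[p] x≡y[m]
... | inj₂ y≤x = sym (crt-≡-ordered coprime y≤x (sym x≡y[p]) (sym x≡y[m]))

coprime-%≢0 : ∀ {p m x} .{{_ : NonZero p}} → p ≢ 1 → Coprime x (p * m) → x % p ≢ 0
coprime-%≢0 {p} {m} {x} p≢1 coprime x%p≡0 = p≢1 (coprime (m%n≡0⇒n∣m x p x%p≡0 , m∣m*n m))

coprime-% : ∀ {p m x} .{{_ : NonZero m}} → Coprime x (p * m) → Coprime (x % m) m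
coprime-% {p} coprime (d∣x%m , d∣m) = coprime (∣n∣m%n⇒∣m d∣m d∣x%m , ∣n⇒∣m*n p d∣m)

coprime-from-residues : ∀ {p m x} .{{_ : NonZero p}} .{{_ : NonZero m}} →
  Prime p → x % p ≢ 0 → Coprime (x % m) m → Coprime x (p * m)
coprime-from-residues {p} {m} {x} p-prime x%p≢0 coprime {d} (d∣x , d∣pm) = coprime (%-presˡ-∣ d∣x d∣m , d∣m)
  where
  d∣m : d ∣ m
  d∣m = coprime-divisor coprime-d-p d∣pm
    where
    coprime-d-p : Coprime d p
    coprime-d-p (e∣d , e∣p) with prime⇒irreducible p-prime e∣p
    ... | inj₁ e≡1 = e≡1
    ... | inj₂ refl = contradiction (n∣m⇒m%n≡0 x p (∣-trans e∣d d∣x)) x%p≢0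

count-blocks : ∀ p m .{{_ : NonZero p}} .{{_ : NonZero m}} (F : ℕ → ℕ → Bool) →
  count (p * m) (λ z → positive (z / m) ∧ F (z / m) (z % m)) ≡ ∑[ i < pred p ] count m (F (suc i))
count-blocks (suc n) m F = begin
  count (suc n * m) P                                 ≡⟨ ∑-blocks (suc n) m (indicator ∘ P) ⟩
  ∑[ r < suc n ] ∑[ y < m ] indicator (P (r * m + y))
    ≡⟨ ∑-cong (suc n) (λ r _ → count-cong m λ y y<m →
         cong₂ (λ a b → positive a ∧ F a b) ([r*m+y]/m≡r r y<m) ([r*m+y]%m≡y r y<m)) ⟩
  count m (λ _ → false) + ∑[ i < n ] count m (F (suc i))
    ≡⟨ cong (_+ ∑[ i < n ] count m (F (suc i))) (trans (∑-const m 0) (*-zeroʳ m)) ⟩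
  ∑[ i < n ] count m (F (suc i))                      ∎
  where
  open ≡-Reasoning
  P : ℕ → Bool
  P z = positive (z / m) ∧ F (z / m) (z % m)

-- ⌊_⌋ rather than does, so that toWitness applies; count-units relates it to unitsSubset.
isUnit : ℕ → ℕ → Bool
isUnit q x = ⌊ coprime? x q ⌋

isUnit-intro : ∀ {q x} → Coprime x q → T (isUnit q x)
isUnit-intro {q} {x} coprime = fromWitness {a? = coprime? x q} (λ {d} → coprime {d})

isUnit-elim : ∀ {q x} → T (isUnit q x) → Coprime x q
isUnit-elim {q} {x} = toWitness {a? = coprime? x q}

member : ∀ {n} → Vec Bool n → ℕ → Bool
member Vec.[]       _       = false
member (b Vec.∷ v) zero    = b
member (b Vec.∷ v) (suc x) = member v x

count-member : ∀ {n} (v : Vec Bool n) → count n (member v) ≡ ∣ v ∣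
count-member Vec.[]           = refl
count-member (true Vec.∷ v)  = cong suc (count-member v)
count-member (false Vec.∷ v) = count-member v

member-lookup : ∀ {n} (v : Vec Bool n) (i : Fin n) → member v (toℕ i) ≡ lookup v i
member-lookup (b Vec.∷ v) Fin.zero    = refl
member-lookup (b Vec.∷ v) (Fin.suc i) = member-lookup v i

count-units : ∀ q → count q (isUnit q) ≡ φ q
count-units q = trans (count-cong q unit≡member) (count-member (unitsSubset q))
  where
  unit≡member : ∀ x → x < q → isUnit q x ≡ member (unitsSubset q) x
  unit≡member x x<q = sym (begin
    member (unitsSubset q) x                       ≡⟨ cong (member (unitsSubset q)) (toℕ-fromℕ< x<q) ⟨
    member (unitsSubset q) (toℕ (fromℕ< x<q)) ≡⟨ member-lookup (unitsSubset q) (fromℕ< x<q) ⟩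
    lookup (unitsSubset q) (fromℕ< x<q)            ≡⟨ lookup∘tabulate _ (fromℕ< x<q) ⟩
    does (coprime? (toℕ (fromℕ< x<q)) q)      ≡⟨ cong (λ y → does (coprime? y q)) (toℕ-fromℕ< x<q) ⟩
    does (coprime? x q)                            ≡⟨ isYes≗does (coprime? x q) ⟨
    isUnit q x                                     ∎)
    where open ≡-Reasoning

-- Induction over the prime factorisation

UnitsBelow : ℕ → (ℕ → Bool) → Set
UnitsBelow q X = ∀ x → x < q → T (X x) → Coprime x q

record FourSum (q : ℕ) .{{_ : NonZero q}} (X Y Z W : ℕ → Bool) (t : ℕ) : Set where
  constructor fourSum
  field
    x y z w   : ℕ
    x<q       : x < q
    y<q       : y < q
    z<q       : z < q
    w<q       : w < q
    x∈X       : T (X x)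
    y∈Y       : T (Y y)
    z∈Z       : T (Z z)
    w∈W       : T (W w)
    x+y+z+w≡t : (x + y + z + w) % q ≡ t % q

-- The theorem for four possibly different sets, which is what passes to the fibres.
FourSumsCover : ℕ → Set
FourSumsCover q = .{{_ : NonZero q}} → ∀ X Y Z W →
  UnitsBelow q X → UnitsBelow q Y → UnitsBelow q Z → UnitsBelow q W →
  φ q < count q X + count q Y → φ q < count q Z + count q W →
  ∀ t → (2 ∣ q → 2 ∣ t) → FourSum q X Y Z W t

fourSumsCover-1 : FourSumsCover 1
fourSumsCover-1 X Y Z W _ _ _ _ large₁₂ large₃₄ t _
  with both-members (X 0) (Y 0) large₁₂ | both-members (Z 0) (W 0) large₃₄
  where
  both-members : ∀ a b → 1 < indicator a + 0 + (indicator b + 0) → T a × T b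
  both-members true  true  _ = tt , tt
  both-members true  false (s<s ())
  both-members false true  (s<s ())
... | X0 , Y0 | Z0 , W0 = fourSum 0 0 0 0 z<s z<s z<s z<s X0 Y0 Z0 W0 (sym (n%1≡0 t))

module Lift (p m : ℕ) .{{_ : NonZero p}} .{{_ : NonZero m}} (p-prime : Prime p) (coprime : Coprime p m) where

  instance
    pm≢0 : NonZero (p * m)
    pm≢0 = m*n≢0 p m

  -- the pair (x mod p, x mod m), encoded as a number below p·m
  crt : ℕ → ℕ
  crt x = x % p * m + x % m

  crt-/ : ∀ x → crt x / m ≡ x % p
  crt-/ x = [r*m+y]/m≡r (x % p) (m%n<n x m)

  crt-% : ∀ x → crt x % m ≡ x % m
  crt-% x = [r*m+y]%m≡y (x % p) (m%n<n x m)

  crt-< : ∀ x → crt x < p * m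
  crt-< x = begin-strict
    x % p * m + x % m  <⟨ +-monoʳ-< (x % p * m) (m%n<n x m) ⟩
    x % p * m + m      ≡⟨ +-comm (x % p * m) m ⟩
    suc (x % p) * m    ≤⟨ *-monoˡ-≤ m (m%n<n x p) ⟩
    p * m              ∎
    where open ≤-Reasoning

  crt-injective : ∀ x y → x < p * m → y < p * m → crt x ≡ crt y → x ≡ y
  crt-injective x y x<pm y<pm crt-x≡crt-y = begin
    x             ≡⟨ m<n⇒m%n≡m x<pm ⟨
    x % (p * m)   ≡⟨ crt-≡ coprime (trans (sym (crt-/ x)) (trans (cong (_/ m) crt-x≡crt-y) (crt-/ y)))
                                   (trans (sym (crt-% x)) (trans (cong (_% m) crt-x≡crt-y) (crt-% y))) ⟩
    y % (p * m)   ≡⟨ m<n⇒m%n≡m y<pm ⟩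
    y             ∎
    where open ≡-Reasoning

  fiber? : (X : ℕ → Bool) (r y : ℕ) → Dec (∃[ x ] x < p * m × T (X x) × x % p ≡ r × x % m ≡ y)
  fiber? X r y = anyUpTo? (λ x → T? (X x) ×-dec (x % p ≟ r ×-dec x % m ≟ y)) (p * m)

  fiber : (ℕ → Bool) → ℕ → ℕ → Bool
  fiber X r y = ⌊ fiber? X r y ⌋

  fiberSize : (ℕ → Bool) → ℕ → ℕ
  fiberSize X r = count m (fiber X r)

  fiber-witness : ∀ {X r y} → T (fiber X r y) → ∃[ x ] x < p * m × T (X x) × x % p ≡ r × x % m ≡ y
  fiber-witness {X} {r} {y} = toWitness {a? = fiber? X r y}

  fiber-point : ∀ {X r y} → r < p → y < m → T (fiber X r y) →
    ∃[ x ] x < p * m × T (X x) × x % p ≡ r % p × x % m ≡ y % m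
  fiber-point {X} {r} {y} r<p y<m fiber-r-y with fiber-witness {X} {r} {y} fiber-r-y
  ... | x , x<pm , Xx , x%p≡r , x%m≡y =
    x , x<pm , Xx , trans x%p≡r (sym (m<n⇒m%n≡m r<p)) , trans x%m≡y (sym (m<n⇒m%n≡m y<m))

  fiber-units : ∀ {X r} → UnitsBelow (p * m) X → UnitsBelow m (fiber X r)
  fiber-units {X} {r} X-units y y<m fiber-r-y with fiber-witness {X} {r} {y} fiber-r-y
  ... | x , x<pm , Xx , _ , x%m≡y = subst (λ z → Coprime z m) x%m≡y (coprime-% {p} (X-units x x<pm Xx))

  p≢1 : p ≢ 1
  p≢1 p≡1 = ¬prime[1] (subst Prime p≡1 p-prime)

  count-≤-fibers : ∀ {X} → UnitsBelow (p * m) X → count (p * m) X ≤ ∑[ i < pred p ] fiberSize X (suc i)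
  count-≤-fibers {X} X-units = begin
    count (p * m) X          ≤⟨ count-mono (p * m) {X} {P ∘ crt} X⇒P∘crt ⟩
    count (p * m) (P ∘ crt)  ≡⟨ count-∘-injective (p * m) P crt (λ x _ → crt-< x) crt-injective ⟩
    count (p * m) P          ≡⟨ count-blocks p m (fiber X) ⟩
    ∑[ i < pred p ] fiberSize X (suc i) ∎
    where
    open ≤-Reasoning
    P : ℕ → Bool
    P z = positive (z / m) ∧ fiber X (z / m) (z % m)
    X⇒P∘crt : ∀ x → x < p * m → T (X x) → T (P (crt x))
    X⇒P∘crt x x<pm Xx rewrite crt-/ x | crt-% x = Equivalence.from T-∧
      (positive-≢0 (coprime-%≢0 p≢1 (X-units x x<pm Xx)) , fromWitness (x , x<pm , Xx , refl , refl))

  φ-lowerBound : pred p * φ m ≤ φ (p * m)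
  φ-lowerBound = begin
    pred p * φ m                       ≡⟨ ∑-const (pred p) (φ m) ⟨
    ∑[ i < pred p ] φ m                ≡⟨ ∑-cong (pred p) (λ _ _ → count-units m) ⟨
    ∑[ i < pred p ] count m (isUnit m) ≡⟨ count-blocks p m (λ _ → isUnit m) ⟨
    count (p * m) P                    ≡⟨ count-∘-injective (p * m) P crt (λ x _ → crt-< x) crt-injective ⟨
    count (p * m) (P ∘ crt)            ≤⟨ count-mono (p * m) {P ∘ crt} {isUnit (p * m)} P∘crt⇒unit ⟩
    count (p * m) (isUnit (p * m))     ≡⟨ count-units (p * m) ⟩
    φ (p * m)                          ∎
    where
    open ≤-Reasoning
    P : ℕ → Bool
    P z = positive (z / m) ∧ isUnit m (z % m)
    P∘crt⇒unit : ∀ x → x < p * m → T (P (crt x)) → T (isUnit (p * m) x)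
    P∘crt⇒unit x _ Pcrtx with Equivalence.to T-∧ (subst₂ (λ a b → T (positive a ∧ isUnit m b)) (crt-/ x) (crt-% x) Pcrtx)
    ... | x%p-positive , x%m-unit =
      isUnit-intro (coprime-from-residues p-prime (positive⇒≢0 x%p-positive) (isUnit-elim x%m-unit))

  fibers-large : ∀ {X Y} → UnitsBelow (p * m) X → UnitsBelow (p * m) Y → φ (p * m) < count (p * m) X + count (p * m) Y →
    pred p * φ m < ∑[ i < pred p ] fiberSize X (suc i) + ∑[ i < pred p ] fiberSize Y (suc i)
  fibers-large X-units Y-units large = ≤-<-trans φ-lowerBound
    (<-≤-trans large (+-mono-≤ (count-≤-fibers X-units) (count-≤-fibers Y-units)))

  lift : ∀ {X Y Z W t r₁ r₂ r₃ r₄} → r₁ < p → r₂ < p → r₃ < p → r₄ < p →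
    (r₁ + r₂ + r₃ + r₄) % p ≡ t % p →
    FourSum m (fiber X r₁) (fiber Y r₂) (fiber Z r₃) (fiber W r₄) t → FourSum (p * m) X Y Z W t
  lift r₁<p r₂<p r₃<p r₄<p r≡t (fourSum y₁ y₂ y₃ y₄ y₁<m y₂<m y₃<m y₄<m F₁ F₂ F₃ F₄ y≡t)
    with fiber-point r₁<p y₁<m F₁ | fiber-point r₂<p y₂<m F₂ | fiber-point r₃<p y₃<m F₃ | fiber-point r₄<p y₄<m F₄
  ... | x₁ , x₁<pm , Xx₁ , x₁≡r₁ , x₁≡y₁ | x₂ , x₂<pm , Yx₂ , x₂≡r₂ , x₂≡y₂
      | x₃ , x₃<pm , Zx₃ , x₃≡r₃ , x₃≡y₃ | x₄ , x₄<pm , Wx₄ , x₄≡r₄ , x₄≡y₄ =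
    fourSum x₁ x₂ x₃ x₄ x₁<pm x₂<pm x₃<pm x₄<pm Xx₁ Yx₂ Zx₃ Wx₄
      (crt-≡ coprime (trans (%-cong-+₄ x₁≡r₁ x₂≡r₂ x₃≡r₃ x₄≡r₄) r≡t)
                     (trans (%-cong-+₄ x₁≡y₁ x₂≡y₂ x₃≡y₃ x₄≡y₄) y≡t))

  step : FourSumsCover m → FourSumsCover (p * m)
  step cover X Y Z W X-units Y-units Z-units W-units large₁₂ large₃₄ t parity
    with chooseResidues p (φ m) t (fiberSize X) (fiberSize Y) (fiberSize Z) (fiberSize W) p-prime
           (parity ∘ ∣m⇒∣m*n m) (fibers-large X-units Y-units large₁₂) (fibers-large Z-units W-units large₃₄)
  ... | residueChoice s₁ s₂ (largeSplit r₁ r₂ r₁<p r₂<p r₁+r₂≡s₁ large₁₂′)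
                            (largeSplit r₃ r₄ r₃<p r₄<p r₃+r₄≡s₂ large₃₄′) s₁+s₂≡t =
    lift r₁<p r₂<p r₃<p r₄<p r≡t
      (cover (fiber X r₁) (fiber Y r₂) (fiber Z r₃) (fiber W r₄)
             (fiber-units X-units) (fiber-units Y-units) (fiber-units Z-units) (fiber-units W-units)
             large₁₂′ large₃₄′ t (parity ∘ ∣n⇒∣m*n p))
    where
    r≡t : (r₁ + r₂ + r₃ + r₄) % p ≡ t % p
    r≡t = trans (cong (_% p) (trans (+-assoc (r₁ + r₂) r₃ r₄) (cong₂ _+_ r₁+r₂≡s₁ r₃+r₄≡s₂))) s₁+s₂≡t

squareFree-∣ : ∀ {d q} → d ∣ q → SquareFree q → SquareFree d
squareFree-∣ d∣q squareFree p p-prime pp∣d = squareFree p p-prime (∣-trans pp∣d d∣q)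

squareFree⇒coprime : ∀ {p m} → Prime p → SquareFree (p * m) → Coprime p m
squareFree⇒coprime {p} p-prime squareFree (d∣p , d∣m) with prime⇒irreducible p-prime d∣p
... | inj₁ d≡1 = d≡1
... | inj₂ refl = contradiction (*-monoʳ-∣ p d∣m) (squareFree p p-prime)

fourSumsCover-primes : ∀ ps → All Prime ps → SquareFree (product ps) → FourSumsCover (product ps)
fourSumsCover-primes []       All.[]                    _          = fourSumsCover-1
fourSumsCover-primes (p ∷ ps) (p-prime All.∷ ps-prime) squareFree =
  Lift.step p (product ps) {{prime⇒nonZero p-prime}} {{productOfPrimes≢0 ps-prime}} p-prime
    (squareFree⇒coprime p-prime squareFree) (fourSumsCover-primes ps ps-prime (squareFree-∣ (n∣m*n p) squareFree))

fourSumsCover : ∀ q .{{_ : NonZero q}} → SquareFree q → FourSumsCover q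
fourSumsCover q squareFree = subst FourSumsCover (sym isFactorisation)
  (fourSumsCover-primes factors factorsPrime (subst SquareFree isFactorisation squareFree))
  where open PrimeFactorisation (factorise q)

-- Subsets of Fin q and the parity condition

member-∈ : ∀ {n} (A : Subset n) {i} → T (member A (toℕ i)) → i ∈ A
member-∈ A {i} Ai = lookup⇒[]= i A (Equivalence.to T-≡ (subst T (member-lookup A i) Ai))

member-fromℕ< : ∀ {n x} (A : Subset n) (x<n : x < n) → T (member A x) → fromℕ< x<n ∈ A
member-fromℕ< A x<n Ax = member-∈ A (subst (T ∘ member A) (sym (toℕ-fromℕ< x<n)) Ax)

member-units : ∀ {q} (A : Subset q) → (∀ x → x ∈ A → Coprime (toℕ x) q) → UnitsBelow q (member A)
member-units {q} A A-units x x<q Ax =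
  subst (λ y → Coprime y q) (toℕ-fromℕ< x<q) (A-units (fromℕ< x<q) (member-fromℕ< A x<q Ax))

InFourfoldSumset : ∀ {q} .{{_ : NonZero q}} → Subset q → Fin q → Set
InFourfoldSumset {q} A a = ∃[ a₁ ] ∃[ a₂ ] ∃[ a₃ ] ∃[ a₄ ]
  (a₁ ∈ A × a₂ ∈ A × a₃ ∈ A × a₄ ∈ A × (toℕ a₁ + toℕ a₂ + toℕ a₃ + toℕ a₄) % q ≡ toℕ a)

fourSum⇒sumset : ∀ {q} .{{_ : NonZero q}} (A : Subset q) (a : Fin q) →
  FourSum q (member A) (member A) (member A) (member A) (toℕ a) → InFourfoldSumset A a
fourSum⇒sumset {q} A a (fourSum x y z w x<q y<q z<q w<q Ax Ay Az Aw x+y+z+w≡a) =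
  fromℕ< x<q , fromℕ< y<q , fromℕ< z<q , fromℕ< w<q ,
  member-fromℕ< A x<q Ax , member-fromℕ< A y<q Ay , member-fromℕ< A z<q Az , member-fromℕ< A w<q Aw , (begin
    (toℕ (fromℕ< x<q) + toℕ (fromℕ< y<q) + toℕ (fromℕ< z<q) + toℕ (fromℕ< w<q)) % q
      ≡⟨ cong (_% q) (cong₂ _+_ (cong₂ _+_ (cong₂ _+_ (toℕ-fromℕ< x<q) (toℕ-fromℕ< y<q)) (toℕ-fromℕ< z<q))
                                (toℕ-fromℕ< w<q)) ⟩
    (x + y + z + w) % q ≡⟨ x+y+z+w≡a ⟩
    toℕ a % q           ≡⟨ m<n⇒m%n≡m (toℕ<n a) ⟩
    toℕ a               ∎)
  where open ≡-Reasoning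

coprime-even⇒odd : ∀ {x q} → 2 ∣ q → Coprime x q → x % 2 ≡ 1
coprime-even⇒odd {x} 2∣q coprime with x % 2 in x%2 | m%n<n x 2
... | 0 | _ = contradiction (coprime (m%n≡0⇒n∣m x 2 x%2 , 2∣q)) λ ()
... | 1 | _ = refl
... | suc (suc _) | s<s (s<s ())

units-sum-even : ∀ {q x₁ x₂ x₃ x₄} .{{_ : NonZero q}} → 2 ∣ q →
  Coprime x₁ q → Coprime x₂ q → Coprime x₃ q → Coprime x₄ q → 2 ∣ (x₁ + x₂ + x₃ + x₄) % q
units-sum-even {q} {x₁} {x₂} {x₃} {x₄} 2∣q c₁ c₂ c₃ c₄ = m%n≡0⇒n∣m _ 2 (begin
  (x₁ + x₂ + x₃ + x₄) % q % 2 ≡⟨ m∣n⇒o%n%m≡o%m 2 q (x₁ + x₂ + x₃ + x₄) 2∣q ⟩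
  (x₁ + x₂ + x₃ + x₄) % 2     ≡⟨ %-cong-+₄ {x₁} {x₂} {x₃} {x₄} {1} {1} {1} {1} {2}
                                   (odd c₁) (odd c₂) (odd c₃) (odd c₄) ⟩
  4 % 2                       ≡⟨⟩
  0                           ∎)
  where
  open ≡-Reasoning
  odd : ∀ {x} → Coprime x q → x % 2 ≡ 1 % 2
  odd = coprime-even⇒odd 2∣q

sumset-parity : ∀ {q} .{{_ : NonZero q}} (A : Subset q) → (∀ x → x ∈ A → Coprime (toℕ x) q) →
  ∀ a → InFourfoldSumset A a → 2 ∣ q → 2 ∣ toℕ a
sumset-parity A A-units a (a₁ , a₂ , a₃ , a₄ , a₁∈A , a₂∈A , a₃∈A , a₄∈A , sum≡a) 2∣q =
  subst (2 ∣_) sum≡a (units-sum-even 2∣q (A-units a₁ a₁∈A) (A-units a₂ a₂∈A) (A-units a₃ a₃∈A) (A-units a₄ a₄∈A))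

gcd[2,q]∣⇔ : ∀ q a → gcd 2 q ∣ a ⇔ (2 ∣ q → 2 ∣ a)
gcd[2,q]∣⇔ q a = mk⇔ to from
  where
  to : gcd 2 q ∣ a → 2 ∣ q → 2 ∣ a
  to gcd∣a 2∣q = subst (_∣ a) (∣-antisym (gcd[m,n]∣m 2 q) (gcd-greatest ∣-refl 2∣q)) gcd∣a
  from : (2 ∣ q → 2 ∣ a) → gcd 2 q ∣ a
  from parity with prime⇒irreducible prime[2] (gcd[m,n]∣m 2 q)
  ... | inj₁ gcd≡1 = subst (_∣ a) (sym gcd≡1) (1∣ a)
  ... | inj₂ gcd≡2 = subst (_∣ a) (sym gcd≡2) (parity (subst (_∣ q) gcd≡2 (gcd[m,n]∣n 2 q)))

theorem1p2 : (q : ℕ) → .{{_ : NonZero q}} → SquareFree q →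
    (A : Subset q) → (∀ x → x ∈ A → Coprime (toℕ x) q) →
    φ q < 2 * ∣ A ∣ →
    (a : Fin q) →
      (∃[ a₁ ] ∃[ a₂ ] ∃[ a₃ ] ∃[ a₄ ]
        (a₁ ∈ A × a₂ ∈ A × a₃ ∈ A × a₄ ∈ A ×
         (toℕ a₁ + toℕ a₂ + toℕ a₃ + toℕ a₄) % q ≡ toℕ a))
      ⇔ (gcd 2 q ∣ toℕ a)
theorem1p2 q squareFree A A-units large a =
  mk⇔ (Equivalence.from parity⇔ ∘ sumset-parity A A-units a) (fourSum⇒sumset A a ∘ cover ∘ Equivalence.to parity⇔)
  where
  parity⇔ : gcd 2 q ∣ toℕ a ⇔ (2 ∣ q → 2 ∣ toℕ a)
  parity⇔ = gcd[2,q]∣⇔ q (toℕ a)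
  X : ℕ → Bool
  X = member A
  X-units : UnitsBelow q X
  X-units = member-units A A-units
  large′ : φ q < count q X + count q X
  large′ = subst (λ c → φ q < c + c) (sym (count-member A)) (subst (φ q <_) (cong (∣ A ∣ +_) (+-identityʳ ∣ A ∣)) large)
  cover : (2 ∣ q → 2 ∣ toℕ a) → FourSum q X X X X (toℕ a)
  cover = fourSumsCover q squareFree X X X X X-units X-units X-units X-units large′ large′ (toℕ a)
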